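{- For any $d, R \in \mathbb{N}$ there exists a function $f\colon \mathbb{Z}^d \to \mathcal{I}_R^{2d}$ that is $R$-locally injective and $1$-Lipschitz, where both $\mathbb{Z}^d$ and $\mathcal{I}_R^{2d}\subseteq\mathbb{Z}^{2d}$ are equipped with the metric induced by $\|\cdot\|_\infty$.
   Context: $\mathcal{I}_R = \{0,1,\dots,R\} \subseteq \mathbb{Z}$, and $\mathcal{I}_R^{2d}$ is viewed as a subset of $\mathbb{Z}^{2d}$. A map $f\colon X\to Y$ between metric spaces is $1$-Lipschitz if $d_Y(f(x),f(y))\leq d_X(x,y)$ for all $x,y$, and $R$-locally injective if $f(x)\neq f(y)$ whenever $0<d_X(x,y)\leq R$. -}

module Defs where

open import Data.Nat using (ℕ; suc; _⊔_; _≤_; _<_; _*_)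
open import Data.Integer using (ℤ; ∣_∣; _-_; +_)
open import Data.Fin using (Fin; toℕ)
open import Data.Product using (_×_)
open import Relation.Binary.PropositionalEquality using (_≡_; _≢_)

ℤ^ : ℕ → Set
ℤ^ n = Fin n → ℤ

maxFin : ∀ {n} → (Fin n → ℕ) → ℕ
maxFin {ℕ.zero} f = 0
maxFin {suc n} f = f Fin.zero ⊔ maxFin (λ i → f (Fin.suc i))

dist∞ : ∀ {n} → ℤ^ n → ℤ^ n → ℕ
dist∞ x y = maxFin (λ i → ∣ x i - y i ∣)

-- I_R = {0,1,...,R}, I_R^m ⊆ ℤ^m
I^ : ℕ → ℕ → Set
I^ R m = Fin m → Fin (suc R)

incl : ∀ {R m} → I^ R m → ℤ^ m
incl p i = + toℕ (p i)

distI : ∀ {R m} → I^ R m → I^ R m → ℕ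
distI p q = dist∞ (incl p) (incl q)

OneLipschitz : ∀ {d R m} → (ℤ^ d → I^ R m) → Set
OneLipschitz f = ∀ x y → distI (f x) (f y) ≤ dist∞ x y

LocallyInjective : ∀ {d R' m} → ℕ → (ℤ^ d → I^ R' m) → Set
LocallyInjective R f = ∀ x y → 0 < dist∞ x y → dist∞ x y ≤ R → f x ≢ f y

{-# OPTIONS --safe #-}

-- The triangle wave of period P = 2R, wave x = distance from x to Pℤ, takes values in
-- {0, …, R}, is 1-Lipschitz, and wave x = wave y forces P ∣ x - y or P ∣ x + y. Map each
-- coordinate t to (wave t, wave (t + 1)). If two points at distance in (0, R] had the same
-- image, take a coordinate where they differ, s ≠ t with |s - t| ≤ R: then P ∣ s - t, or
-- P divides both s + t and (s + 1) + (t + 1), hence 2, hence 2t and again s - t. But no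
-- multiple of P lies in (0, R].

module Submission where

open import Defs
open import Data.Nat using (ℕ; _*_; zero; suc; _≤_; _<_; z≤n; s≤s; NonZero; >-nonZero)
open import Data.Product using (Σ; _×_; _,_; ∃; map; uncurry)

import Data.Nat as ℕ
open import Data.Nat.Properties
  using (≤-refl; ≤-trans; ≤-total; <⇒≤; <⇒≱; ≤-<-trans; m≤m+n; m≤n+m; m<m+n; m≤n+o⇒m∸n≤o;
         +-cancelˡ-≤; +-monoˡ-≤; +-comm; ⊔-sel; ⊔-lub; m≤m⊔n; m≤n⊔m; module ≤-Reasoning)
import Data.Nat.Divisibility as ℕ using (∣⇒≤)
open import Data.Integer as ℤ using (ℤ; +_; -[1+_]; ∣_∣; _+_; _-_; -_; 0ℤ; 1ℤ; _≟_)
open import Data.Integer.Properties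
  using (m-n≡m⊖n; ∣⊖∣-≤; ∣m⊖n∣≡∣n⊖m∣; ∣i+j∣≤∣i∣+∣j∣; ∣i-j∣≡∣j-i∣;
         ∣i∣≡0⇒i≡0; i-j≡0⇒i≡j; +-identityʳ)
open import Data.Integer.DivMod using (_%ℕ_; _/ℕ_; a≡a%ℕn+[a/ℕn]*n; n%ℕd<d)
open import Data.Integer.Divisibility.Signed
  using (_∣_; divides; ∣⇒∣ᵤ; ∣m∣n⇒∣m+n; ∣m∣n⇒∣m-n; ∣n⇒∣m*n)
open import Data.Integer.Tactic.RingSolver using (solve)
open import Data.Fin as Fin using (Fin; toℕ; fromℕ<; combine; remQuot)
open import Data.Fin.Properties using (toℕ-fromℕ<; remQuot-combine)
open import Data.List using (_∷_; [])
open import Data.Sum using (_⊎_; inj₁; inj₂)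
open import Function using (_∘_; id)
open import Relation.Nullary using (¬_; yes; no)
open import Relation.Binary.PropositionalEquality
  using (_≡_; _≢_; _≗_; refl; sym; trans; cong; cong₂; cong-app; subst; subst₂; module ≡-Reasoning)

f≤maxFin : ∀ {n} (f : Fin n → ℕ) i → f i ≤ maxFin f
f≤maxFin f Fin.zero    = m≤m⊔n _ _
f≤maxFin f (Fin.suc i) = ≤-trans (f≤maxFin (f ∘ Fin.suc) i) (m≤n⊔m _ _)

maxFin-lub : ∀ {n} (f : Fin n → ℕ) m → (∀ i → f i ≤ m) → maxFin f ≤ m
maxFin-lub {zero}  f m f≤m = z≤n
maxFin-lub {suc n} f m f≤m = ⊔-lub (f≤m Fin.zero) (maxFin-lub (f ∘ Fin.suc) m (f≤m ∘ Fin.suc))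

m<maxFin⇒∃m<f : ∀ {n} (f : Fin n → ℕ) {m} → m < maxFin f → ∃ λ i → m < f i
m<maxFin⇒∃m<f {suc n} f {m} m<max with ⊔-sel (f Fin.zero) (maxFin (f ∘ Fin.suc))
... | inj₁ max≡f0   = Fin.zero , subst (m <_) max≡f0 m<max
... | inj₂ max≡rest = map Fin.suc id (m<maxFin⇒∃m<f (f ∘ Fin.suc) (subst (m <_) max≡rest m<max))

∣+m-+n∣≤o : ∀ {m n o} → m ≤ n ℕ.+ o → n ≤ m ℕ.+ o → ∣ + m - + n ∣ ≤ o
∣+m-+n∣≤o {m} {n} {o} m≤n+o n≤m+o with ≤-total m n
... | inj₁ m≤n = begin
  ∣ + m - + n ∣ ≡⟨ cong ∣_∣ (m-n≡m⊖n m n) ⟩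
  ∣ m ℤ.⊖ n ∣   ≡⟨ ∣⊖∣-≤ m≤n ⟩
  n ℕ.∸ m       ≤⟨ m≤n+o⇒m∸n≤o n m n≤m+o ⟩
  o             ∎
  where open ≤-Reasoning
... | inj₂ n≤m = begin
  ∣ + m - + n ∣ ≡⟨ cong ∣_∣ (m-n≡m⊖n m n) ⟩
  ∣ m ℤ.⊖ n ∣   ≡⟨ ∣m⊖n∣≡∣n⊖m∣ m n ⟩
  ∣ n ℤ.⊖ m ∣   ≡⟨ ∣⊖∣-≤ n≤m ⟩
  m ℕ.∸ n       ≤⟨ m≤n+o⇒m∸n≤o m n m≤n+o ⟩
  o             ∎
  where open ≤-Reasoning

∣i-k∣≤∣i-j∣+∣j-k∣ : ∀ i j k → ∣ i - k ∣ ≤ ∣ i - j ∣ ℕ.+ ∣ j - k ∣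
∣i-k∣≤∣i-j∣+∣j-k∣ i j k = begin
  ∣ i - k ∣             ≡⟨ cong ∣_∣ i-k≡[i-j]+[j-k] ⟩
  ∣ (i - j) + (j - k) ∣ ≤⟨ ∣i+j∣≤∣i∣+∣j∣ (i - j) (j - k) ⟩
  ∣ i - j ∣ ℕ.+ ∣ j - k ∣ ∎
  where
  open ≤-Reasoning
  i-k≡[i-j]+[j-k] : i - k ≡ (i - j) + (j - k)
  i-k≡[i-j]+[j-k] = solve (i ∷ j ∷ k ∷ [])

x+c≡r+m⇒x-m≡r-c : ∀ x c r m → x + c ≡ r + m → x - m ≡ r - c
x+c≡r+m⇒x-m≡r-c x c r m eq = begin
  x - m           ≡⟨ solve (x ∷ c ∷ m ∷ []) ⟩
  (x + c) - m - c ≡⟨ cong (λ t → t - m - c) eq ⟩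
  (r + m) - m - c ≡⟨ solve (r ∷ m ∷ c ∷ []) ⟩
  r - c           ∎
  where open ≡-Reasoning

∣i∣≡∣j∣⇒i≡j⊎i≡-j : ∀ i j → ∣ i ∣ ≡ ∣ j ∣ → i ≡ j ⊎ i ≡ - j
∣i∣≡∣j∣⇒i≡j⊎i≡-j (+ m)    (+ .m)          refl = inj₁ refl
∣i∣≡∣j∣⇒i≡j⊎i≡-j (+ _)    -[1+ n ]        refl = inj₂ refl
∣i∣≡∣j∣⇒i≡j⊎i≡-j -[1+ m ] (+ .(suc m))    refl = inj₂ refl
∣i∣≡∣j∣⇒i≡j⊎i≡-j -[1+ m ] -[1+ .m ]       refl = inj₁ refl

n∣i⇒n≤∣i∣ : ∀ {n i} → + n ∣ i → i ≢ 0ℤ → n ≤ ∣ i ∣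
n∣i⇒n≤∣i∣ {i = i} n∣i i≢0 = ℕ.∣⇒≤ {{≢-nonZero}} (∣⇒∣ᵤ n∣i)
  where
  ≢-nonZero : NonZero ∣ i ∣
  ≢-nonZero = ℕ.≢-nonZero (i≢0 ∘ ∣i∣≡0⇒i≡0)

∣x-a∣≡∣y-b∣⇒∣x-y⊎∣x+y : ∀ {k a b} x y → k ∣ a → k ∣ b →
                         ∣ x - a ∣ ≡ ∣ y - b ∣ → (k ∣ x - y) ⊎ (k ∣ x + y)
∣x-a∣≡∣y-b∣⇒∣x-y⊎∣x+y {k} {a} {b} x y k∣a k∣b eq with ∣i∣≡∣j∣⇒i≡j⊎i≡-j (x - a) (y - b) eq
... | inj₁ same = inj₁ (subst (k ∣_) a-b≡x-y (∣m∣n⇒∣m-n k∣a k∣b))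
  where
  open ≡-Reasoning
  a-b≡x-y : a - b ≡ x - y
  a-b≡x-y = begin
    a - b                         ≡⟨ solve (a ∷ b ∷ x ∷ y ∷ []) ⟩
    (y - b) - (x - a) + (x - y)   ≡⟨ cong (λ t → (y - b) - t + (x - y)) same ⟩
    (y - b) - (y - b) + (x - y)   ≡⟨ solve (y ∷ b ∷ x ∷ []) ⟩
    x - y                         ∎
... | inj₂ opposite = inj₂ (subst (k ∣_) a+b≡x+y (∣m∣n⇒∣m+n k∣a k∣b))
  where
  open ≡-Reasoning
  a+b≡x+y : a + b ≡ x + y
  a+b≡x+y = begin
    a + b                           ≡⟨ solve (a ∷ b ∷ x ∷ y ∷ []) ⟩
    (x + y) - ((x - a) + (y - b))   ≡⟨ cong (λ t → (x + y) - (t + (y - b))) opposite ⟩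
    (x + y) - (- (y - b) + (y - b)) ≡⟨ solve (x ∷ y ∷ b ∷ []) ⟩
    x + y                           ∎

module TriangleWave (R : ℕ) .{{_ : NonZero R}} where

  P : ℕ
  P = R ℕ.+ R

  instance
    P-nonZero : NonZero P
    P-nonZero = >-nonZero (≤-trans (ℕ.>-nonZero⁻¹ R) (m≤m+n R R))

  nearestMultiple : ℤ → ℤ
  nearestMultiple x = (x + + R) /ℕ P ℤ.* + P

  P∣nearestMultiple : ∀ x → + P ∣ nearestMultiple x
  P∣nearestMultiple x = divides ((x + + R) /ℕ P) refl

  wave : ℤ → ℕ
  wave x = ∣ x - nearestMultiple x ∣

  x-nearestMultiple≡[x+R]%P-R : ∀ x → x - nearestMultiple x ≡ + ((x + + R) %ℕ P) - + R
  x-nearestMultiple≡[x+R]%P-R x =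
    x+c≡r+m⇒x-m≡r-c x (+ R) (+ ((x + + R) %ℕ P)) (nearestMultiple x) (a≡a%ℕn+[a/ℕn]*n (x + + R) P)

  wave≤R : ∀ x → wave x ≤ R
  wave≤R x = subst (_≤ R) (cong ∣_∣ (sym (x-nearestMultiple≡[x+R]%P-R x)))
    (∣+m-+n∣≤o (<⇒≤ (n%ℕd<d (x + + R) P)) (m≤n+m R _))

  -- Distinct multiples of P are R + R apart, so every multiple other than the nearest one is
  -- at least R ≥ wave x away from x.
  wave-minimal : ∀ x {a} → + P ∣ a → wave x ≤ ∣ x - a ∣
  wave-minimal x {a} P∣a with nearestMultiple x ≟ a
  ... | yes refl = ≤-refl
  ... | no m≢a   = ≤-trans (wave≤R x) (+-cancelˡ-≤ R R ∣ x - a ∣ (begin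
    R ℕ.+ R                 ≤⟨ P≤∣m-a∣ ⟩
    ∣ m - a ∣               ≤⟨ ∣i-k∣≤∣i-j∣+∣j-k∣ m x a ⟩
    ∣ m - x ∣ ℕ.+ ∣ x - a ∣ ≡⟨ cong (ℕ._+ ∣ x - a ∣) (∣i-j∣≡∣j-i∣ m x) ⟩
    wave x ℕ.+ ∣ x - a ∣    ≤⟨ +-monoˡ-≤ ∣ x - a ∣ (wave≤R x) ⟩
    R ℕ.+ ∣ x - a ∣         ∎))
    where
    open ≤-Reasoning
    m = nearestMultiple x
    P≤∣m-a∣ : P ≤ ∣ m - a ∣
    P≤∣m-a∣ = n∣i⇒n≤∣i∣ (∣m∣n⇒∣m-n (P∣nearestMultiple x) P∣a) (m≢a ∘ i-j≡0⇒i≡j m a)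

  wave≤wave+dist : ∀ x y → wave x ≤ wave y ℕ.+ ∣ x - y ∣
  wave≤wave+dist x y = begin
    wave x                          ≤⟨ wave-minimal x (P∣nearestMultiple y) ⟩
    ∣ x - nearestMultiple y ∣       ≤⟨ ∣i-k∣≤∣i-j∣+∣j-k∣ x y (nearestMultiple y) ⟩
    ∣ x - y ∣ ℕ.+ wave y            ≡⟨ +-comm ∣ x - y ∣ (wave y) ⟩
    wave y ℕ.+ ∣ x - y ∣            ∎
    where open ≤-Reasoning

  wave-lipschitz : ∀ x y → ∣ + wave x - + wave y ∣ ≤ ∣ x - y ∣
  wave-lipschitz x y = ∣+m-+n∣≤o (wave≤wave+dist x y)
    (subst (λ t → wave y ≤ wave x ℕ.+ t) (∣i-j∣≡∣j-i∣ y x) (wave≤wave+dist y x))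

  wave≡wave⇒∣x-y⊎∣x+y : ∀ x y → wave x ≡ wave y → (+ P ∣ x - y) ⊎ (+ P ∣ x + y)
  wave≡wave⇒∣x-y⊎∣x+y x y =
    ∣x-a∣≡∣y-b∣⇒∣x-y⊎∣x+y x y (P∣nearestMultiple x) (P∣nearestMultiple y)

  -- In the last case P divides (x + 1) + (y + 1) - (x + y) = 2, hence 2y and (x + y) - 2y.
  wave-pair≡⇒P∣x-y : ∀ x y → wave x ≡ wave y → wave (x + 1ℤ) ≡ wave (y + 1ℤ) → + P ∣ x - y
  wave-pair≡⇒P∣x-y x y eq eq₁
    with wave≡wave⇒∣x-y⊎∣x+y x y eq | wave≡wave⇒∣x-y⊎∣x+y (x + 1ℤ) (y + 1ℤ) eq₁
  ... | inj₁ P∣x-y | _ = P∣x-y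
  ... | inj₂ _     | inj₁ P∣x₁-y₁ = subst (+ P ∣_) x₁-y₁≡x-y P∣x₁-y₁
    where
    x₁-y₁≡x-y : (x + 1ℤ) - (y + 1ℤ) ≡ x - y
    x₁-y₁≡x-y = solve (x ∷ y ∷ [])
  ... | inj₂ P∣x+y | inj₂ P∣x₁+y₁ = subst (+ P ∣_) x+y-y*2≡x-y (∣m∣n⇒∣m-n P∣x+y (∣n⇒∣m*n y P∣2))
    where
    x₁+y₁-[x+y]≡2 : (x + 1ℤ) + (y + 1ℤ) - (x + y) ≡ + 2
    x₁+y₁-[x+y]≡2 = solve (x ∷ y ∷ [])
    P∣2 : + P ∣ + 2
    P∣2 = subst (+ P ∣_) x₁+y₁-[x+y]≡2 (∣m∣n⇒∣m-n P∣x₁+y₁ P∣x+y)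
    x+y-y*2≡x-y : (x + y) - y ℤ.* + 2 ≡ x - y
    x+y-y*2≡x-y = solve (x ∷ y ∷ [])

  wave≡wave⇒wave[x+1]≢wave[y+1] : ∀ x y → 0 < ∣ x - y ∣ → ∣ x - y ∣ ≤ R →
                                  wave x ≡ wave y → wave (x + 1ℤ) ≢ wave (y + 1ℤ)
  wave≡wave⇒wave[x+1]≢wave[y+1] x y 0<dist dist≤R eq eq₁ =
    <⇒≱ (≤-<-trans dist≤R R<P) (ℕ.∣⇒≤ {{>-nonZero 0<dist}} (∣⇒∣ᵤ (wave-pair≡⇒P∣x-y x y eq eq₁)))
    where
    R<P : R < P
    R<P = m<m+n R (ℕ.>-nonZero⁻¹ R)

  waveFin : ℤ → Fin (suc R)
  waveFin x = fromℕ< (s≤s (wave≤R x))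

  toℕ-waveFin : ∀ x → toℕ (waveFin x) ≡ wave x
  toℕ-waveFin x = toℕ-fromℕ< (s≤s (wave≤R x))

OneLipschitzℤ : ∀ {R m} → (ℤ → I^ R m) → Set
OneLipschitzℤ g = ∀ x y → distI (g x) (g y) ≤ ∣ x - y ∣

-- Equality of images is taken pointwise, since function extensionality is not available.
LocallyInjectiveℤ : ∀ {R′ m} → ℕ → (ℤ → I^ R′ m) → Set
LocallyInjectiveℤ R g = ∀ x y → 0 < ∣ x - y ∣ → ∣ x - y ∣ ≤ R → ¬ (g x ≗ g y)

wavePair : (R : ℕ) → ℤ → I^ R 2
wavePair zero      x i = Fin.zero
wavePair R@(suc _) x i = waveFin (x + + toℕ i)
  where open TriangleWave R

wavePair-oneLipschitz : ∀ R → OneLipschitzℤ (wavePair R)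
wavePair-oneLipschitz zero      x y = z≤n
wavePair-oneLipschitz R@(suc _) x y = maxFin-lub {2} _ ∣ x - y ∣ (shifted-lipschitz ∘ +_ ∘ toℕ)
  where
  open TriangleWave R
  open ≤-Reasoning
  shifted-lipschitz : ∀ s → ∣ + toℕ (waveFin (x + s)) - + toℕ (waveFin (y + s)) ∣ ≤ ∣ x - y ∣
  shifted-lipschitz s = begin
    ∣ + toℕ (waveFin (x + s)) - + toℕ (waveFin (y + s)) ∣
      ≡⟨ cong₂ (λ a b → ∣ + a - + b ∣) (toℕ-waveFin (x + s)) (toℕ-waveFin (y + s)) ⟩
    ∣ + wave (x + s) - + wave (y + s) ∣ ≤⟨ wave-lipschitz (x + s) (y + s) ⟩
    ∣ (x + s) - (y + s) ∣               ≡⟨ cong ∣_∣ [x+s]-[y+s]≡x-y ⟩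
    ∣ x - y ∣                           ∎
    where
    [x+s]-[y+s]≡x-y : (x + s) - (y + s) ≡ x - y
    [x+s]-[y+s]≡x-y = solve (x ∷ y ∷ s ∷ [])

wavePair-locallyInjective : ∀ R → LocallyInjectiveℤ R (wavePair R)
wavePair-locallyInjective zero      x y 0<dist dist≤0 _ = <⇒≱ 0<dist dist≤0
wavePair-locallyInjective R@(suc _) x y 0<dist dist≤R same =
  wave≡wave⇒wave[x+1]≢wave[y+1] x y 0<dist dist≤R
    (subst₂ (λ a b → wave a ≡ wave b) (+-identityʳ x) (+-identityʳ y) (wave-agree Fin.zero))
    (wave-agree (Fin.suc Fin.zero))
  where
  open TriangleWave R
  wave-agree : ∀ i → wave (x + + toℕ i) ≡ wave (y + + toℕ i)
  wave-agree i =
    trans (sym (toℕ-waveFin (x + + toℕ i))) (trans (cong toℕ (same i)) (toℕ-waveFin (y + + toℕ i)))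

coordinatewise : ∀ {R m} d → (ℤ → I^ R m) → ℤ^ d → I^ R (m * d)
coordinatewise d g x k = uncurry (λ s j → g (x j) s) (remQuot d k)

coordinatewise-combine : ∀ {R m d} (g : ℤ → I^ R m) x s j →
                         coordinatewise d g x (combine s j) ≡ g (x j) s
coordinatewise-combine g x s j = cong (uncurry (λ s j → g (x j) s)) (remQuot-combine s j)

coordinatewise-oneLipschitz : ∀ {R m} d (g : ℤ → I^ R m) →
                              OneLipschitzℤ g → OneLipschitz (coordinatewise d g)
coordinatewise-oneLipschitz d g g-lip x y = maxFin-lub _ (dist∞ x y) λ k →
  let (s , j) = remQuot d k in
  ≤-trans (f≤maxFin (λ s → ∣ + toℕ (g (x j) s) - + toℕ (g (y j) s) ∣) s)
    (≤-trans (g-lip (x j) (y j)) (f≤maxFin (λ j → ∣ x j - y j ∣) j))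

coordinatewise-locallyInjective : ∀ {R m} d (g : ℤ → I^ R m) →
                                  LocallyInjectiveℤ R g → LocallyInjective R (coordinatewise d g)
coordinatewise-locallyInjective d g g-inj x y 0<dist dist≤R same
  with m<maxFin⇒∃m<f (λ j → ∣ x j - y j ∣) 0<dist
... | j , 0<distⱼ =
  g-inj (x j) (y j) 0<distⱼ (≤-trans (f≤maxFin (λ j → ∣ x j - y j ∣) j) dist≤R) λ s →
    trans (sym (coordinatewise-combine g x s j))
      (trans (cong-app same (combine s j)) (coordinatewise-combine g y s j))

lemma3p6 : (d R : ℕ) → Σ (ℤ^ d → I^ R (2 * d)) (λ f → LocallyInjective R f × OneLipschitz f)
lemma3p6 d R = coordinatewise d (wavePair R)
             , coordinatewise-locallyInjective d (wavePair R) (wavePair-locallyInjective R)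
             , coordinatewise-oneLipschitz d (wavePair R) (wavePair-oneLipschitz R)
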